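{- Let $G$ and $H$ be two connected graphs of orders $n_1\ge 2$ and $n_2\ge 2$ and maximum degrees $\Delta_1$ and $\Delta_2$, respectively. (i) If $\Delta_1\ne n_1-1$ or $\Delta_2\ne n_2-1$, then $\varpi(G+H)=\varpi(G)+\varpi(H)$. (ii) If $\Delta_1=n_1-1$ and $\Delta_2=n_2-1$, then $\varpi(G+H)=\varpi(G)+\varpi(H)-1$.
   Context: All graphs are finite and simple. The join $G+H$ is the graph obtained from disjoint copies of $G$ and $H$ by adding an edge between every vertex of $G$ and every vertex of $H$. Two distinct vertices $x,y$ of a graph are true twins if they have equal closed neighborhoods. A twin-free clique is a set of vertices inducing a clique and containing no two true twins (of the ambient graph); $\varpi(\cdot)$ denotes the maximum cardinality of a twin-free clique. -}

module Defs where

open import Data.Nat using (ℕ; _+_; _≤_; _⊔_)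
open import Data.Bool using (Bool; true; false; _∨_)
open import Data.Fin using (Fin; splitAt; _≟_)
open import Data.Fin.Subset using (Subset; _∈_; ∣_∣)
open import Data.Sum using (_⊎_; inj₁; inj₂)
open import Data.Product using (Σ; _×_; _,_)
open import Data.List using (foldr; map; allFin)
open import Data.Vec using (tabulate)
open import Relation.Nullary using (¬_)
open import Relation.Nullary.Decidable using (⌊_⌋)
open import Relation.Binary.PropositionalEquality using (_≡_; _≢_; refl)

record Graph (n : ℕ) : Set where
  field
    adj    : Fin n → Fin n → Bool
    sym    : ∀ x y → adj x y ≡ adj y x
    irrefl : ∀ x → adj x x ≡ false
open Graph public

degree : ∀ {n} → Graph n → Fin n → ℕ
degree G v = ∣ tabulate (adj G v) ∣

maxDegree : ∀ {n} → Graph n → ℕ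
maxDegree {n} G = foldr _⊔_ 0 (map (degree G) (allFin n))

data Reach {n} (G : Graph n) : Fin n → Fin n → Set where
  here : ∀ {x} → Reach G x x
  step : ∀ {x y z} → adj G x y ≡ true → Reach G y z → Reach G x z

Connected : ∀ {n} → Graph n → Set
Connected G = ∀ x y → Reach G x y

closedN : ∀ {n} → Graph n → Fin n → Fin n → Bool
closedN G x z = ⌊ x ≟ z ⌋ ∨ adj G x z

TrueTwins : ∀ {n} → Graph n → Fin n → Fin n → Set
TrueTwins G x y = x ≢ y × (∀ z → closedN G x z ≡ closedN G y z)

TwinFreeClique : ∀ {n} → Graph n → Subset n → Set
TwinFreeClique G S =
  (∀ x y → x ∈ S → y ∈ S → x ≢ y → adj G x y ≡ true) ×
  (∀ x y → x ∈ S → y ∈ S → ¬ TrueTwins G x y)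

IsTwinFreeCliqueNumber : ∀ {n} → Graph n → ℕ → Set
IsTwinFreeCliqueNumber G k =
  (Σ _ λ S → TwinFreeClique G S × ∣ S ∣ ≡ k) ×
  (∀ S → TwinFreeClique G S → ∣ S ∣ ≤ k)

-- join G + H on Fin (n₁ + n₂): first n₁ vertices are G, the rest H
private
  jadj : ∀ {n₁ n₂} → Graph n₁ → Graph n₂ → Fin (n₁ + n₂) → Fin (n₁ + n₂) → Bool
  jadj {n₁} G H x y with splitAt n₁ x | splitAt n₁ y
  ... | inj₁ a | inj₁ b = adj G a b
  ... | inj₂ a | inj₂ b = adj H a b
  ... | inj₁ _ | inj₂ _ = true
  ... | inj₂ _ | inj₁ _ = true

  jsym : ∀ {n₁ n₂} (G : Graph n₁) (H : Graph n₂) x y → jadj G H x y ≡ jadj G H y x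
  jsym {n₁} G H x y with splitAt n₁ x | splitAt n₁ y
  ... | inj₁ a | inj₁ b = sym G a b
  ... | inj₂ a | inj₂ b = sym H a b
  ... | inj₁ _ | inj₂ _ = refl
  ... | inj₂ _ | inj₁ _ = refl

  jirr : ∀ {n₁ n₂} (G : Graph n₁) (H : Graph n₂) x → jadj G H x x ≡ false
  jirr {n₁} G H x with splitAt n₁ x
  ... | inj₁ a = irrefl G a
  ... | inj₂ a = irrefl H a

_+ᴳ_ : ∀ {n₁ n₂} → Graph n₁ → Graph n₂ → Graph (n₁ + n₂)
G +ᴳ H = record { adj = jadj G H ; sym = jsym G H ; irrefl = jirr G H }

-- In G + H a vertex of G and a vertex of H are true twins exactly when both are
-- universal, while two vertices on the same side are twins in G + H exactly when
-- they are twins in their own graph. Hence a twin-free clique of G + H is the union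
-- of twin-free cliques of G and H that do not both contain a universal vertex,
-- which gives ϖ(G + H) ≤ ϖ(G) + ϖ(H), with equality when G or H has no universal
-- vertex (Δ = n - 1 means exactly that a universal vertex exists). If both have
-- universal vertices, then every maximum twin-free clique contains one (otherwise
-- a universal vertex could be added), so the bound is not attained; removing the
-- universal vertex from a maximum twin-free clique of H attains ϖ(G) + ϖ(H) - 1.
module Submission where

open import Defs
open import Function using (_∘_)
open import Data.Nat using (ℕ; suc; _+_; _∸_; _≤_; _<_; _≥_; _⊔_; z≤n; s≤s)
open import Data.Nat.Properties
  using (≤-refl; ≤-antisym; ≤-trans; ≤-reflexive; ≤∧≢⇒<; <⇒≱; +-mono-≤; +-monoʳ-≤; +-cancelʳ-≤;
         +-cancelˡ-≡; +-suc; ∸-monoˡ-≤; ⊔-sel; ⊔-lub; m≤n⇒m≤n⊔o; m≤n⇒m≤o⊔n)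
open import Data.Bool using (Bool; true; false; _∨_)
open import Data.Bool.Properties using (∨-zeroʳ) renaming (_≟_ to _≟ᵇ_)
open import Data.Fin using (Fin; zero; suc; _↑ˡ_; _↑ʳ_; splitAt; _≟_)
open import Data.Fin.Properties
  using (suc-injective; splitAt-↑ˡ; splitAt-↑ʳ; splitAt⁻¹-↑ˡ; splitAt⁻¹-↑ʳ; ↑ˡ-injective; ↑ʳ-injective; all?; any?)
open import Data.Fin.Subset using (Subset; ⊤; inside; outside; _∈_; _∉_; _⊆_; _⊂_; _∪_; _─_; _-_; ⁅_⁆; ∣_∣)
open import Data.Fin.Subset.Properties
  using (_∈?_; ∈⊤; ∣⊤∣≡n; ∣p∣≤n; ∣p∣≡n⇒p≡⊤; p⊆q⇒∣p∣≤∣q∣; p⊂q⇒∣p∣<∣q∣; x∈⁅x⁆; x∈⁅y⁆⇒x≡y;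
         x∉⁅y⁆⇒x≢y; p⊆p∪q; q⊆p∪q; x∈p∪q⁻; p─q⊆p; p─⊥≡p)
open import Data.Vec using (_∷_; []; _++_; tabulate; take; drop; here; there)
open import Data.Vec.Properties
  using (lookup∘tabulate; tabulate-cong; []=⇒lookup; lookup⇒[]=; lookup-++ˡ; lookup-++ʳ; take++drop≡id)
open import Data.List using (map; allFin)
open import Data.List.Properties using (foldr-preservesᵇ; foldr-preservesᵒ)
open import Data.List.Membership.Propositional.Properties using (∈-allFin)
import Data.List.Relation.Unary.All as All
import Data.List.Relation.Unary.All.Properties as All
import Data.List.Relation.Unary.Any as Any
import Data.List.Relation.Unary.Any.Properties as Any
open import Data.Sum using (_⊎_; inj₁; inj₂; [_,_]′; map₂)
open import Data.Product using (_×_; ∃; ∃₂; ∃-syntax; _,_; proj₁; proj₂)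
open import Relation.Nullary using (¬_; Dec; yes; no; contradiction)
open import Relation.Nullary.Decidable using (⌊_⌋; _×-dec_)
import Relation.Binary.PropositionalEquality as ≡
open ≡ using (_≡_; _≢_; refl; trans; cong; cong₂; subst; module ≡-Reasoning)

m≤o∧n≤p∧m+n≡o+p⇒m≡o∧n≡p : ∀ {m n o p} → m ≤ o → n ≤ p → m + n ≡ o + p → m ≡ o × n ≡ p
m≤o∧n≤p∧m+n≡o+p⇒m≡o∧n≡p {m} {n} {o} {p} m≤o n≤p eq =
  m≡o , +-cancelˡ-≡ o n p (subst (λ x → x + n ≡ o + p) m≡o eq)
  where
  m≡o : m ≡ o
  m≡o = ≤-antisym m≤o (+-cancelʳ-≤ n o m (≤-trans (+-monoʳ-≤ o n≤p) (≤-reflexive (≡.sym eq))))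

≟-injective : ∀ {m n} (f : Fin m → Fin n) → (∀ {a c} → f a ≡ f c → a ≡ c) →
              ∀ a c → ⌊ f a ≟ f c ⌋ ≡ ⌊ a ≟ c ⌋
≟-injective f f-injective a c with a ≟ c | f a ≟ f c
... | yes refl | yes _       = refl
... | yes refl | no fa≢fa    = contradiction refl fa≢fa
... | no a≢c   | yes fa≡fc   = contradiction (f-injective fa≡fc) a≢c
... | no _     | no _        = refl

∈-tabulate⁺ : ∀ {n} {f : Fin n → Bool} {x} → f x ≡ true → x ∈ tabulate f
∈-tabulate⁺ {f = f} {x} fx≡true = lookup⇒[]= x _ (trans (lookup∘tabulate f x) fx≡true)

∈-tabulate⁻ : ∀ {n} {f : Fin n → Bool} {x} → x ∈ tabulate f → f x ≡ true
∈-tabulate⁻ {f = f} {x} x∈ = trans (≡.sym (lookup∘tabulate f x)) ([]=⇒lookup x∈)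

∣p++q∣≡∣p∣+∣q∣ : ∀ {m n} (p : Subset m) (q : Subset n) → ∣ p ++ q ∣ ≡ ∣ p ∣ + ∣ q ∣
∣p++q∣≡∣p∣+∣q∣ []            q = refl
∣p++q∣≡∣p∣+∣q∣ (inside  ∷ p) q = cong suc (∣p++q∣≡∣p∣+∣q∣ p q)
∣p++q∣≡∣p∣+∣q∣ (outside ∷ p) q = ∣p++q∣≡∣p∣+∣q∣ p q

x∈p─q⇒x∉q : ∀ {n} {x : Fin n} (p q : Subset n) → x ∈ p ─ q → x ∉ q
x∈p─q⇒x∉q (_ ∷ p) (outside ∷ q) (there x∈p─q) (there x∈q) = x∈p─q⇒x∉q p q x∈p─q x∈q
x∈p─q⇒x∉q (_ ∷ p) (inside  ∷ q) (there x∈p─q) (there x∈q) = x∈p─q⇒x∉q p q x∈p─q x∈q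

x∈p-y⇒x≢y : ∀ {n} {x y : Fin n} (p : Subset n) → x ∈ p - y → x ≢ y
x∈p-y⇒x≢y {y = y} p x∈p-y = x∉⁅y⁆⇒x≢y (x∈p─q⇒x∉q p ⁅ y ⁆ x∈p-y)

suc∣p-x∣≡∣p∣ : ∀ {n} {x : Fin n} (p : Subset n) → x ∈ p → suc ∣ p - x ∣ ≡ ∣ p ∣
suc∣p-x∣≡∣p∣ (inside  ∷ p) here        = cong (suc ∘ ∣_∣) (p─⊥≡p p)
suc∣p-x∣≡∣p∣ (inside  ∷ p) (there x∈p) = cong suc (suc∣p-x∣≡∣p∣ p x∈p)
suc∣p-x∣≡∣p∣ (outside ∷ p) (there x∈p) = suc∣p-x∣≡∣p∣ p x∈p

Universal : ∀ {n} → Graph n → Fin n → Set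
Universal G u = ∀ z → closedN G u z ≡ true

closedNbhd : ∀ {n} → Graph n → Fin n → Subset n
closedNbhd G u = tabulate (closedN G u)

module _ {n} (G : Graph n) where

  universal? : ∀ u → Dec (Universal G u)
  universal? u = all? λ z → closedN G u z ≟ᵇ true

  universal⇒adj : ∀ {u z} → Universal G u → u ≢ z → adj G u z ≡ true
  universal⇒adj {u} {z} U u≢z with u ≟ z | U z
  ... | yes u≡z | _        = contradiction u≡z u≢z
  ... | no _    | adj≡true = adj≡true

  twins-sym : ∀ {x y} → TrueTwins G x y → TrueTwins G y x
  twins-sym (x≢y , same) = x≢y ∘ ≡.sym , ≡.sym ∘ same

  twins⇒universal : ∀ {x y} → TrueTwins G x y → Universal G x → Universal G y
  twins⇒universal (_ , same) U z = trans (≡.sym (same z)) (U z)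

  universal⇒twins : ∀ {x y} → Universal G x → Universal G y → x ≢ y → TrueTwins G x y
  universal⇒twins Ux Uy x≢y = x≢y , λ z → trans (Ux z) (≡.sym (Uy z))

  ∣closedNbhd∣≡1+degree : ∀ u → ∣ closedNbhd G u ∣ ≡ suc (degree G u)
  ∣closedNbhd∣≡1+degree u = count-≟∨ u (adj G u) (irrefl G u)
    where
    count-≟∨ : ∀ {m} (v : Fin m) (f : Fin m → Bool) → f v ≡ false →
               ∣ tabulate (λ z → ⌊ v ≟ z ⌋ ∨ f z) ∣ ≡ suc ∣ tabulate f ∣
    count-≟∨ zero    f fv≡false rewrite fv≡false = refl
    -- ⌊ suc v ≟ suc z ⌋ is not definitionally ⌊ v ≟ z ⌋, hence the tabulate-cong.
    count-≟∨ (suc v) f fv≡false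
      with f zero
         | trans (cong ∣_∣ (tabulate-cong λ z → cong (_∨ f (suc z)) (≟-injective suc suc-injective v z)))
                 (count-≟∨ v (f ∘ suc) fv≡false)
    ... | true  | ih = cong suc ih
    ... | false | ih = ih

  universal⇒∣closedNbhd∣≡n : ∀ {u} → Universal G u → ∣ closedNbhd G u ∣ ≡ n
  universal⇒∣closedNbhd∣≡n {u} U = ≤-antisym (∣p∣≤n (closedNbhd G u))
    (subst (_≤ ∣ closedNbhd G u ∣) (∣⊤∣≡n n) (p⊆q⇒∣p∣≤∣q∣ {p = ⊤} λ {z} _ → ∈-tabulate⁺ (U z)))

  ∣closedNbhd∣≡n⇒universal : ∀ {u} → ∣ closedNbhd G u ∣ ≡ n → Universal G u
  ∣closedNbhd∣≡n⇒universal full z = ∈-tabulate⁻ (subst (z ∈_) (≡.sym (∣p∣≡n⇒p≡⊤ full)) ∈⊤)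

  degree≤n∸1 : ∀ u → degree G u ≤ n ∸ 1
  degree≤n∸1 u = ∸-monoˡ-≤ 1 (subst (_≤ n) (∣closedNbhd∣≡1+degree u) (∣p∣≤n (closedNbhd G u)))

  universal⇒degree≡n∸1 : ∀ {u} → Universal G u → degree G u ≡ n ∸ 1
  universal⇒degree≡n∸1 {u} U =
    cong (_∸ 1) (trans (≡.sym (∣closedNbhd∣≡1+degree u)) (universal⇒∣closedNbhd∣≡n U))

  degree≤maxDegree : ∀ u → degree G u ≤ maxDegree G
  degree≤maxDegree u =
    foldr-preservesᵒ {P = degree G u ≤_} {f = _⊔_} (λ x y → [ m≤n⇒m≤n⊔o y , m≤n⇒m≤o⊔n x ]′)
      0 (map (degree G) (allFin n))
    (inj₂ (Any.map⁺ (Any.map (λ { refl → ≤-refl }) (∈-allFin u))))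

  maxDegree≤n∸1 : maxDegree G ≤ n ∸ 1
  maxDegree≤n∸1 =
    foldr-preservesᵇ {P = _≤ n ∸ 1} {f = _⊔_} ⊔-lub z≤n (All.map⁺ (All.universal degree≤n∸1 (allFin n)))

  universal⇒maxDegree≡n∸1 : ∀ {u} → Universal G u → maxDegree G ≡ n ∸ 1
  universal⇒maxDegree≡n∸1 {u} U =
    ≤-antisym maxDegree≤n∸1 (subst (_≤ maxDegree G) (universal⇒degree≡n∸1 U) (degree≤maxDegree u))

degree≡n∸1⇒universal : ∀ {n} (G : Graph n) {u} → degree G u ≡ n ∸ 1 → Universal G u
degree≡n∸1⇒universal {suc n} G {u} d =
  ∣closedNbhd∣≡n⇒universal G (trans (∣closedNbhd∣≡1+degree G u) (cong suc d))

maxDegree≡n∸1⇒universal : ∀ {n} (G : Graph n) → n ≥ 2 → maxDegree G ≡ n ∸ 1 → ∃ (Universal G)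
maxDegree≡n∸1⇒universal {n} G n≥2 =
  foldr-preservesᵇ {P = Attained} {f = _⊔_} attained-⊔ (λ 0≡n∸1 → contradiction 0≡n∸1 (nonzero n≥2))
    (All.map⁺ (All.universal (λ u d → u , degree≡n∸1⇒universal G d) (allFin n)))
  where
  Attained : ℕ → Set
  Attained m = m ≡ n ∸ 1 → ∃ (Universal G)
  attained-⊔ : ∀ {x y} → Attained x → Attained y → Attained (x ⊔ y)
  attained-⊔ {x} {y} ax ay with ⊔-sel x y
  ... | inj₁ x⊔y≡x = ax ∘ trans (≡.sym x⊔y≡x)
  ... | inj₂ x⊔y≡y = ay ∘ trans (≡.sym x⊔y≡y)
  nonzero : ∀ {m} → m ≥ 2 → 0 ≢ m ∸ 1
  nonzero (s≤s (s≤s _)) ()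

module _ {n} (G : Graph n) where

  twinFreeClique-⊆ : ∀ {A B} → TwinFreeClique G A → B ⊆ A → TwinFreeClique G B
  twinFreeClique-⊆ (clique , twinFree) B⊆A =
    (λ x y x∈ y∈ → clique x y (B⊆A x∈) (B⊆A y∈)) , (λ x y x∈ y∈ → twinFree x y (B⊆A x∈) (B⊆A y∈))

  twinFreeClique-∪-universal : ∀ {A u} → TwinFreeClique G A → Universal G u →
                               (∀ {w} → w ∈ A → ¬ Universal G w) → TwinFreeClique G (A ∪ ⁅ u ⁆)
  twinFreeClique-∪-universal {A} {u} (clique , twinFree) U noUniversal = clique′ , twinFree′
    where
    ∈-∪⁻ : ∀ {x} → x ∈ A ∪ ⁅ u ⁆ → x ∈ A ⊎ x ≡ u
    ∈-∪⁻ = map₂ (x∈⁅y⁆⇒x≡y u) ∘ x∈p∪q⁻ A ⁅ u ⁆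
    clique′ : ∀ x y → x ∈ A ∪ ⁅ u ⁆ → y ∈ A ∪ ⁅ u ⁆ → x ≢ y → adj G x y ≡ true
    clique′ x y x∈ y∈ x≢y with ∈-∪⁻ x∈ | ∈-∪⁻ y∈
    ... | inj₁ x∈A | inj₁ y∈A = clique x y x∈A y∈A x≢y
    ... | inj₂ refl | _       = universal⇒adj G U x≢y
    ... | inj₁ _   | inj₂ refl = trans (sym G x y) (universal⇒adj G U (x≢y ∘ ≡.sym))
    twinFree′ : ∀ x y → x ∈ A ∪ ⁅ u ⁆ → y ∈ A ∪ ⁅ u ⁆ → ¬ TrueTwins G x y
    twinFree′ x y x∈ y∈ twins with ∈-∪⁻ x∈ | ∈-∪⁻ y∈
    ... | inj₁ x∈A  | inj₁ y∈A  = twinFree x y x∈A y∈A twins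
    ... | inj₂ refl | inj₁ y∈A  = noUniversal y∈A (twins⇒universal G twins U)
    ... | inj₁ x∈A  | inj₂ refl = noUniversal x∈A (twins⇒universal G (twins-sym G twins) U)
    ... | inj₂ refl | inj₂ refl = proj₁ twins refl

  universal∈maximumTwinFreeClique : ∀ {k A u} → IsTwinFreeCliqueNumber G k → TwinFreeClique G A →
                                    ∣ A ∣ ≡ k → Universal G u → ∃[ w ] w ∈ A × Universal G w
  universal∈maximumTwinFreeClique {k} {A} {u} (_ , maximum) A-tfc ∣A∣≡k U
    with any? (λ w → w ∈? A ×-dec universal? G w)
  ... | yes found = found
  ... | no none   = contradiction (maximum _ (twinFreeClique-∪-universal A-tfc U noUniversal))
                                  (<⇒≱ (subst (_< ∣ A ∪ ⁅ u ⁆ ∣) ∣A∣≡k (p⊂q⇒∣p∣<∣q∣ A⊂A∪⁅u⁆)))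
    where
    noUniversal : ∀ {w} → w ∈ A → ¬ Universal G w
    noUniversal w∈A Uw = none (_ , w∈A , Uw)
    A⊂A∪⁅u⁆ : A ⊂ A ∪ ⁅ u ⁆
    A⊂A∪⁅u⁆ = p⊆p∪q ⁅ u ⁆ , u , q⊆p∪q A ⁅ u ⁆ (x∈⁅x⁆ u) , λ u∈A → noUniversal u∈A U

  universal∉twinFreeClique-minus-universal : ∀ {A w v} → TwinFreeClique G A → w ∈ A → Universal G w →
                                             v ∈ A - w → ¬ Universal G v
  universal∉twinFreeClique-minus-universal {A} (_ , twinFree) w∈A Uw v∈A-w Uv =
    twinFree _ _ (p─q⊆p A _ v∈A-w) w∈A (universal⇒twins G Uv Uw (x∈p-y⇒x≢y A v∈A-w))

↑ˡ≢↑ʳ : ∀ {m n} (a : Fin m) (b : Fin n) → a ↑ˡ n ≢ m ↑ʳ b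
↑ˡ≢↑ʳ {m} {n} a b eq
  with trans (≡.sym (splitAt-↑ˡ m a n)) (trans (cong (splitAt m) eq) (splitAt-↑ʳ m n b))
... | ()

module Join {n₁ n₂} (G : Graph n₁) (H : Graph n₂) where

  G+H : Graph (n₁ + n₂)
  G+H = G +ᴳ H

  data Side : Fin (n₁ + n₂) → Set where
    left  : ∀ a → Side (a ↑ˡ n₂)
    right : ∀ b → Side (n₁ ↑ʳ b)

  side : ∀ x → Side x
  side x with splitAt n₁ x in eq
  ... | inj₁ a = subst Side (splitAt⁻¹-↑ˡ eq) (left a)
  ... | inj₂ b = subst Side (splitAt⁻¹-↑ʳ eq) (right b)

  adj-↑ˡ↑ˡ : ∀ a c → adj G+H (a ↑ˡ n₂) (c ↑ˡ n₂) ≡ adj G a c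
  adj-↑ˡ↑ˡ a c rewrite splitAt-↑ˡ n₁ a n₂ | splitAt-↑ˡ n₁ c n₂ = refl
  adj-↑ˡ↑ʳ : ∀ a d → adj G+H (a ↑ˡ n₂) (n₁ ↑ʳ d) ≡ true
  adj-↑ˡ↑ʳ a d rewrite splitAt-↑ˡ n₁ a n₂ | splitAt-↑ʳ n₁ n₂ d = refl
  adj-↑ʳ↑ˡ : ∀ b c → adj G+H (n₁ ↑ʳ b) (c ↑ˡ n₂) ≡ true
  adj-↑ʳ↑ˡ b c rewrite splitAt-↑ʳ n₁ n₂ b | splitAt-↑ˡ n₁ c n₂ = refl
  adj-↑ʳ↑ʳ : ∀ b d → adj G+H (n₁ ↑ʳ b) (n₁ ↑ʳ d) ≡ adj H b d
  adj-↑ʳ↑ʳ b d rewrite splitAt-↑ʳ n₁ n₂ b | splitAt-↑ʳ n₁ n₂ d = refl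

  closedN-↑ˡ↑ˡ : ∀ a c → closedN G+H (a ↑ˡ n₂) (c ↑ˡ n₂) ≡ closedN G a c
  closedN-↑ˡ↑ˡ a c = cong₂ _∨_ (≟-injective (_↑ˡ n₂) (↑ˡ-injective n₂ _ _) a c) (adj-↑ˡ↑ˡ a c)
  closedN-↑ˡ↑ʳ : ∀ a d → closedN G+H (a ↑ˡ n₂) (n₁ ↑ʳ d) ≡ true
  closedN-↑ˡ↑ʳ a d = trans (cong (_ ∨_) (adj-↑ˡ↑ʳ a d)) (∨-zeroʳ _)
  closedN-↑ʳ↑ˡ : ∀ b c → closedN G+H (n₁ ↑ʳ b) (c ↑ˡ n₂) ≡ true
  closedN-↑ʳ↑ˡ b c = trans (cong (_ ∨_) (adj-↑ʳ↑ˡ b c)) (∨-zeroʳ _)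
  closedN-↑ʳ↑ʳ : ∀ b d → closedN G+H (n₁ ↑ʳ b) (n₁ ↑ʳ d) ≡ closedN H b d
  closedN-↑ʳ↑ʳ b d = cong₂ _∨_ (≟-injective (n₁ ↑ʳ_) (↑ʳ-injective n₁ _ _) b d) (adj-↑ʳ↑ʳ b d)

  twins-↑ˡ⁺ : ∀ {a c} → TrueTwins G a c → TrueTwins G+H (a ↑ˡ n₂) (c ↑ˡ n₂)
  twins-↑ˡ⁺ {a} {c} (a≢c , same) = a≢c ∘ ↑ˡ-injective n₂ a c , same′
    where
    same′ : ∀ z → closedN G+H (a ↑ˡ n₂) z ≡ closedN G+H (c ↑ˡ n₂) z
    same′ z with side z
    ... | left e  = trans (closedN-↑ˡ↑ˡ a e) (trans (same e) (≡.sym (closedN-↑ˡ↑ˡ c e)))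
    ... | right d = trans (closedN-↑ˡ↑ʳ a d) (≡.sym (closedN-↑ˡ↑ʳ c d))

  twins-↑ʳ⁺ : ∀ {b d} → TrueTwins H b d → TrueTwins G+H (n₁ ↑ʳ b) (n₁ ↑ʳ d)
  twins-↑ʳ⁺ {b} {d} (b≢d , same) = b≢d ∘ ↑ʳ-injective n₁ b d , same′
    where
    same′ : ∀ z → closedN G+H (n₁ ↑ʳ b) z ≡ closedN G+H (n₁ ↑ʳ d) z
    same′ z with side z
    ... | left c  = trans (closedN-↑ʳ↑ˡ b c) (≡.sym (closedN-↑ʳ↑ˡ d c))
    ... | right e = trans (closedN-↑ʳ↑ʳ b e) (trans (same e) (≡.sym (closedN-↑ʳ↑ʳ d e)))

  twins-↑ˡ⁻ : ∀ {a c} → TrueTwins G+H (a ↑ˡ n₂) (c ↑ˡ n₂) → TrueTwins G a c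
  twins-↑ˡ⁻ {a} {c} (a≢c , same) =
    a≢c ∘ cong (_↑ˡ n₂) , λ z → trans (≡.sym (closedN-↑ˡ↑ˡ a z)) (trans (same (z ↑ˡ n₂)) (closedN-↑ˡ↑ˡ c z))

  twins-↑ʳ⁻ : ∀ {b d} → TrueTwins G+H (n₁ ↑ʳ b) (n₁ ↑ʳ d) → TrueTwins H b d
  twins-↑ʳ⁻ {b} {d} (b≢d , same) =
    b≢d ∘ cong (n₁ ↑ʳ_) , λ z → trans (≡.sym (closedN-↑ʳ↑ʳ b z)) (trans (same (n₁ ↑ʳ z)) (closedN-↑ʳ↑ʳ d z))

  twins-↑ˡ↑ʳ⇒universal : ∀ {a b} → TrueTwins G+H (a ↑ˡ n₂) (n₁ ↑ʳ b) → Universal G a × Universal H b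
  twins-↑ˡ↑ʳ⇒universal {a} {b} (_ , same) =
    (λ z → trans (≡.sym (closedN-↑ˡ↑ˡ a z)) (trans (same (z ↑ˡ n₂)) (closedN-↑ʳ↑ˡ b z))) ,
    (λ z → trans (≡.sym (closedN-↑ʳ↑ʳ b z)) (trans (≡.sym (same (n₁ ↑ʳ z))) (closedN-↑ˡ↑ʳ a z)))

  universal-↑ˡ : ∀ {a} → Universal G a → Universal G+H (a ↑ˡ n₂)
  universal-↑ˡ {a} U z with side z
  ... | left c  = trans (closedN-↑ˡ↑ˡ a c) (U c)
  ... | right d = closedN-↑ˡ↑ʳ a d

  universal-↑ʳ : ∀ {b} → Universal H b → Universal G+H (n₁ ↑ʳ b)
  universal-↑ʳ {b} U z with side z
  ... | left c  = closedN-↑ʳ↑ˡ b c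
  ... | right d = trans (closedN-↑ʳ↑ʳ b d) (U d)

  ++-surjective : ∀ S → ∃₂ λ (A : Subset n₁) (B : Subset n₂) → A ++ B ≡ S
  ++-surjective S = take n₁ S , drop n₁ S , take++drop≡id n₁ S

  module _ (A : Subset n₁) (B : Subset n₂) where

    ∈-++⁺ˡ : ∀ {a} → a ∈ A → a ↑ˡ n₂ ∈ A ++ B
    ∈-++⁺ˡ {a} a∈A = lookup⇒[]= _ _ (trans (lookup-++ˡ A B a) ([]=⇒lookup a∈A))
    ∈-++⁺ʳ : ∀ {b} → b ∈ B → n₁ ↑ʳ b ∈ A ++ B
    ∈-++⁺ʳ {b} b∈B = lookup⇒[]= _ _ (trans (lookup-++ʳ A B b) ([]=⇒lookup b∈B))
    ∈-++⁻ˡ : ∀ {a} → a ↑ˡ n₂ ∈ A ++ B → a ∈ A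
    ∈-++⁻ˡ {a} a∈ = lookup⇒[]= _ _ (trans (≡.sym (lookup-++ˡ A B a)) ([]=⇒lookup a∈))
    ∈-++⁻ʳ : ∀ {b} → n₁ ↑ʳ b ∈ A ++ B → b ∈ B
    ∈-++⁻ʳ {b} b∈ = lookup⇒[]= _ _ (trans (≡.sym (lookup-++ʳ A B b)) ([]=⇒lookup b∈))

    twinFreeClique-++⁻ : TwinFreeClique G+H (A ++ B) → TwinFreeClique G A × TwinFreeClique H B
    twinFreeClique-++⁻ (clique , twinFree) =
      ( (λ a c a∈ c∈ a≢c → trans (≡.sym (adj-↑ˡ↑ˡ a c))
                             (clique _ _ (∈-++⁺ˡ a∈) (∈-++⁺ˡ c∈) (a≢c ∘ ↑ˡ-injective n₂ a c)))
      , (λ a c a∈ c∈ → twinFree _ _ (∈-++⁺ˡ a∈) (∈-++⁺ˡ c∈) ∘ twins-↑ˡ⁺) )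
      ,
      ( (λ b d b∈ d∈ b≢d → trans (≡.sym (adj-↑ʳ↑ʳ b d))
                             (clique _ _ (∈-++⁺ʳ b∈) (∈-++⁺ʳ d∈) (b≢d ∘ ↑ʳ-injective n₁ b d)))
      , (λ b d b∈ d∈ → twinFree _ _ (∈-++⁺ʳ b∈) (∈-++⁺ʳ d∈) ∘ twins-↑ʳ⁺) )

    twinFreeClique-++⁺ : TwinFreeClique G A → TwinFreeClique H B →
                         (∀ {a b} → a ∈ A → b ∈ B → Universal G a → ¬ Universal H b) →
                         TwinFreeClique G+H (A ++ B)
    twinFreeClique-++⁺ (cliqueA , twinFreeA) (cliqueB , twinFreeB) noUniversalPair = clique , twinFree
      where
      clique : ∀ x y → x ∈ A ++ B → y ∈ A ++ B → x ≢ y → adj G+H x y ≡ true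
      clique x y x∈ y∈ x≢y with side x | side y
      ... | left a  | left c  =
        trans (adj-↑ˡ↑ˡ a c) (cliqueA a c (∈-++⁻ˡ x∈) (∈-++⁻ˡ y∈) (x≢y ∘ cong (_↑ˡ n₂)))
      ... | left a  | right d = adj-↑ˡ↑ʳ a d
      ... | right b | left c  = adj-↑ʳ↑ˡ b c
      ... | right b | right d =
        trans (adj-↑ʳ↑ʳ b d) (cliqueB b d (∈-++⁻ʳ x∈) (∈-++⁻ʳ y∈) (x≢y ∘ cong (n₁ ↑ʳ_)))
      crossFree : ∀ {a b} → a ↑ˡ n₂ ∈ A ++ B → n₁ ↑ʳ b ∈ A ++ B → ¬ TrueTwins G+H (a ↑ˡ n₂) (n₁ ↑ʳ b)
      crossFree a∈ b∈ twins = let Ua , Ub = twins-↑ˡ↑ʳ⇒universal twins in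
                              noUniversalPair (∈-++⁻ˡ a∈) (∈-++⁻ʳ b∈) Ua Ub
      twinFree : ∀ x y → x ∈ A ++ B → y ∈ A ++ B → ¬ TrueTwins G+H x y
      twinFree x y x∈ y∈ with side x | side y
      ... | left a  | left c  = twinFreeA a c (∈-++⁻ˡ x∈) (∈-++⁻ˡ y∈) ∘ twins-↑ˡ⁻
      ... | left a  | right d = crossFree x∈ y∈
      ... | right b | left c  = crossFree y∈ x∈ ∘ twins-sym G+H
      ... | right b | right d = twinFreeB b d (∈-++⁻ʳ x∈) (∈-++⁻ʳ y∈) ∘ twins-↑ʳ⁻

  module _ {k₁ k₂} (ϖG : IsTwinFreeCliqueNumber G k₁) (ϖH : IsTwinFreeCliqueNumber H k₂) where

    ∣twinFreeClique-++∣≤ : ∀ A B → TwinFreeClique G+H (A ++ B) → ∣ A ∣ + ∣ B ∣ ≤ k₁ + k₂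
    ∣twinFreeClique-++∣≤ A B tfc = let A-tfc , B-tfc = twinFreeClique-++⁻ A B tfc in
      +-mono-≤ (proj₂ ϖG A A-tfc) (proj₂ ϖH B B-tfc)

    ∣twinFreeClique∣≤ : ∀ S → TwinFreeClique G+H S → ∣ S ∣ ≤ k₁ + k₂
    ∣twinFreeClique∣≤ S tfc with ++-surjective S
    ... | A , B , refl = subst (_≤ k₁ + k₂) (≡.sym (∣p++q∣≡∣p∣+∣q∣ A B)) (∣twinFreeClique-++∣≤ A B tfc)

    ϖ-join : (∀ {a b} → Universal G a → ¬ Universal H b) → IsTwinFreeCliqueNumber G+H (k₁ + k₂)
    ϖ-join noUniversalPair with proj₁ ϖG | proj₁ ϖH
    ... | A , A-tfc , ∣A∣≡k₁ | B , B-tfc , ∣B∣≡k₂ =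
      ( A ++ B
      , twinFreeClique-++⁺ A B A-tfc B-tfc (λ _ _ → noUniversalPair)
      , trans (∣p++q∣≡∣p∣+∣q∣ A B) (cong₂ _+_ ∣A∣≡k₁ ∣B∣≡k₂) )
      , ∣twinFreeClique∣≤

    module _ {u₁ u₂} (U₁ : Universal G u₁) (U₂ : Universal H u₂) where

      ∣twinFreeClique-++∣≢ : ∀ A B → TwinFreeClique G+H (A ++ B) → ∣ A ∣ + ∣ B ∣ ≢ k₁ + k₂
      ∣twinFreeClique-++∣≢ A B tfc eq =
        let A-tfc , B-tfc     = twinFreeClique-++⁻ A B tfc
            ∣A∣≡k₁ , ∣B∣≡k₂   = m≤o∧n≤p∧m+n≡o+p⇒m≡o∧n≡p (proj₂ ϖG A A-tfc) (proj₂ ϖH B B-tfc) eq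
            w , w∈A , Uw      = universal∈maximumTwinFreeClique G ϖG A-tfc ∣A∣≡k₁ U₁
            v , v∈B , Uv      = universal∈maximumTwinFreeClique H ϖH B-tfc ∣B∣≡k₂ U₂
        in proj₂ tfc _ _ (∈-++⁺ˡ A B w∈A) (∈-++⁺ʳ A B v∈B)
             (universal⇒twins G+H (universal-↑ˡ Uw) (universal-↑ʳ Uv) (↑ˡ≢↑ʳ w v))

      ∣twinFreeClique∣≤∸1 : ∀ S → TwinFreeClique G+H S → ∣ S ∣ ≤ k₁ + k₂ ∸ 1
      ∣twinFreeClique∣≤∸1 S tfc with ++-surjective S
      ... | A , B , refl = subst (_≤ k₁ + k₂ ∸ 1) (≡.sym (∣p++q∣≡∣p∣+∣q∣ A B))
          (∸-monoˡ-≤ 1 (≤∧≢⇒< (∣twinFreeClique-++∣≤ A B tfc) (∣twinFreeClique-++∣≢ A B tfc)))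

      ϖ-join-universal : IsTwinFreeCliqueNumber G+H (k₁ + k₂ ∸ 1)
      ϖ-join-universal with proj₁ ϖG | proj₁ ϖH
      ... | A , A-tfc , ∣A∣≡k₁ | B , B-tfc , ∣B∣≡k₂
        with universal∈maximumTwinFreeClique H ϖH B-tfc ∣B∣≡k₂ U₂
      ... | w , w∈B , Uw =
        ( A ++ (B - w)
        , twinFreeClique-++⁺ A (B - w) A-tfc (twinFreeClique-⊆ H B-tfc (p─q⊆p B ⁅ w ⁆))
            (λ _ v∈B-w _ → universal∉twinFreeClique-minus-universal H B-tfc w∈B Uw v∈B-w)
        , size )
        , ∣twinFreeClique∣≤∸1
        where
        open ≡-Reasoning
        size : ∣ A ++ (B - w) ∣ ≡ k₁ + k₂ ∸ 1
        size = begin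
          ∣ A ++ (B - w) ∣           ≡⟨ ∣p++q∣≡∣p∣+∣q∣ A (B - w) ⟩
          ∣ A ∣ + ∣ B - w ∣          ≡⟨ cong (_+ ∣ B - w ∣) ∣A∣≡k₁ ⟩
          k₁ + ∣ B - w ∣             ≡⟨ cong (_∸ 1) (+-suc k₁ ∣ B - w ∣) ⟨
          k₁ + suc ∣ B - w ∣ ∸ 1     ≡⟨ cong (λ m → k₁ + m ∸ 1) (trans (suc∣p-x∣≡∣p∣ B w∈B) ∣B∣≡k₂) ⟩
          k₁ + k₂ ∸ 1                ∎

lemma3 : ∀ {n₁ n₂} (G : Graph n₁) (H : Graph n₂) → n₁ ≥ 2 → n₂ ≥ 2 →
    Connected G → Connected H → ∀ k₁ k₂ →
    IsTwinFreeCliqueNumber G k₁ → IsTwinFreeCliqueNumber H k₂ →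
    ((maxDegree G ≢ n₁ ∸ 1 ⊎ maxDegree H ≢ n₂ ∸ 1) →
    IsTwinFreeCliqueNumber (G +ᴳ H) (k₁ + k₂)) ×
    ((maxDegree G ≡ n₁ ∸ 1 × maxDegree H ≡ n₂ ∸ 1) →
    IsTwinFreeCliqueNumber (G +ᴳ H) (k₁ + k₂ ∸ 1))
lemma3 {n₁} {n₂} G H n₁≥2 n₂≥2 _ _ k₁ k₂ ϖG ϖH = part-i , part-ii
  where
  open Join G H
  part-i : maxDegree G ≢ n₁ ∸ 1 ⊎ maxDegree H ≢ n₂ ∸ 1 → IsTwinFreeCliqueNumber G+H (k₁ + k₂)
  part-i (inj₁ ΔG≢n₁∸1) = ϖ-join ϖG ϖH λ Ua _ → ΔG≢n₁∸1 (universal⇒maxDegree≡n∸1 G Ua)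
  part-i (inj₂ ΔH≢n₂∸1) = ϖ-join ϖG ϖH λ _ Ub → ΔH≢n₂∸1 (universal⇒maxDegree≡n∸1 H Ub)
  part-ii : maxDegree G ≡ n₁ ∸ 1 × maxDegree H ≡ n₂ ∸ 1 → IsTwinFreeCliqueNumber G+H (k₁ + k₂ ∸ 1)
  part-ii (ΔG≡n₁∸1 , ΔH≡n₂∸1) =
    let _ , U₁ = maxDegree≡n∸1⇒universal G n₁≥2 ΔG≡n₁∸1
        _ , U₂ = maxDegree≡n∸1⇒universal H n₂≥2 ΔH≡n₂∸1
    in ϖ-join-universal ϖG ϖH U₁ U₂
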